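{- Let $a,b,c$ be integers with $a\ne c$, suppose $k=\frac{a}{a-c}\in\mathbb{N}$, let $n=3k$, and suppose $2ab=3ac-bc$. Then: (1) There is no prime $p$ satisfying either (i) $p\mid a$ and $p\nmid bc$, or (ii) $p\mid c$ and $p\nmid ab$. (2) The only prime $p$ that can satisfy $p\mid b$ and $p\nmid ac$ is $p=3$; moreover, in that case $3\,\|\,n$ (i.e. $3\mid n$ and $9\nmid n$). -}

module Defs where

{-# OPTIONS --safe #-}
-- The relation 2ab = 3ac − bc rearranges to bc = 3ac − 2ab, 2ab = c(3a − b) and
-- 3ac = b(2a + c). So a prime dividing a divides bc; a prime dividing b divides 3ac, hence
-- is 3 unless it divides ac; and a prime dividing c divides 2ab, hence ab: for p = 2 write
-- c = 2s, so ab = s(3a − b), and 3a − b is even when a and b are odd. Finally 9 ∣ n = 3k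
-- would give 3 ∣ k, hence 3 ∣ k(a − c) = a and 3 ∣ ac.
module Submission where

open import Defs
open import Data.Nat using (ℕ)
open import Data.Nat.Primality using (Prime)
open import Data.Integer using (ℤ; +_; _*_; _-_)
open import Data.Integer.Divisibility using (_∣_)
open import Data.Product using (_×_)
open import Data.Sum using (_⊎_)
open import Relation.Nullary using (¬_)
open import Relation.Binary.PropositionalEquality using (_≡_; _≢_)
import Data.Nat as ℕ
import Data.Nat.Divisibility as ℕD

open import Function using (_∘_)
open import Data.List using (_∷_; [])
open import Data.Product using (∃; _,_)
open import Data.Sum using (inj₁; inj₂)
import Data.Sum as Sum
open import Data.Nat using (s≤s)
open import Data.Nat.Primality using (euclidsLemma; prime⇒irreducible; ¬prime[1]; prime[2]; prime?)
open import Data.Integer using (_+_; _%ℕ_; _/ℕ_)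
open import Data.Integer.Properties using (abs-*; *-cancelˡ-≡; +-identityˡ)
open import Data.Integer.DivMod using (n%ℕd<d; a≡a%ℕn+[a/ℕn]*n)
open import Data.Integer.Divisibility.Signed
  using (divides; ∣ᵤ⇒∣; ∣⇒∣ᵤ; _∣?_; ∣-refl; ∣m⇒∣m*n; ∣n⇒∣m*n; ∣m∣n⇒∣m+n; ∣m∣n⇒∣m-n)
  renaming (_∣_ to _∣ₛ_)
open import Data.Integer.Tactic.RingSolver using (solve; solve-∀)
open import Relation.Nullary using (contradiction)
open import Relation.Nullary.Decidable using (from-yes; decidable-stable)
open import Relation.Binary.PropositionalEquality
  using (refl; sym; trans; cong; subst; module ≡-Reasoning)

prime∣prime⇒≡ : ∀ {p q} → Prime p → Prime q → p ℕD.∣ q → p ≡ q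
prime∣prime⇒≡ p-prime q-prime p∣q with prime⇒irreducible q-prime p∣q
... | inj₁ refl = contradiction p-prime ¬prime[1]
... | inj₂ p≡q  = p≡q

prime[3] : Prime 3
prime[3] = from-yes (prime? 3)

prime∣*⇒∣⊎∣ : ∀ {p} x y → Prime p → (+ p) ∣ x * y → (+ p) ∣ x ⊎ (+ p) ∣ y
prime∣*⇒∣⊎∣ {p} x y p-prime p∣xy =
  euclidsLemma _ _ p-prime (subst (p ℕD.∣_) (abs-* x y) p∣xy)

¬2∣⇒≡1+q*2 : ∀ x → ¬ (+ 2 ∣ₛ x) → ∃ λ q → x ≡ + 1 + q * + 2
¬2∣⇒≡1+q*2 x 2∤x with x %ℕ 2 | n%ℕd<d x 2 | a≡a%ℕn+[a/ℕn]*n x 2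
... | 0 | _ | x≡0+q*2 =
  contradiction (divides (x /ℕ 2) (trans x≡0+q*2 (+-identityˡ _))) 2∤x
... | 1 | _ | x≡1+q*2 = x /ℕ 2 , x≡1+q*2
... | ℕ.suc (ℕ.suc _) | s≤s (s≤s ()) | _

¬2∣∧¬2∣⇒2∣- : ∀ x y → ¬ (+ 2 ∣ₛ x) → ¬ (+ 2 ∣ₛ y) → + 2 ∣ₛ x - y
¬2∣∧¬2∣⇒2∣- x y 2∤x 2∤y with ¬2∣⇒≡1+q*2 x 2∤x | ¬2∣⇒≡1+q*2 y 2∤y
... | q , refl | r , refl = divides (q - r) (odd-difference q r)
  where
  odd-difference : ∀ q r → (+ 1 + q * + 2) - (+ 1 + r * + 2) ≡ (q - r) * + 2
  odd-difference = solve-∀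

module DivisorsOf (a b c : ℤ) (eq : + 2 * a * b ≡ + 3 * a * c - b * c) where
  open ≡-Reasoning

  bc≡3ac-2ab : b * c ≡ + 3 * a * c - + 2 * a * b
  bc≡3ac-2ab = begin
    b * c                                ≡⟨ solve (a ∷ b ∷ c ∷ []) ⟩
    + 3 * a * c - (+ 3 * a * c - b * c)  ≡⟨ cong (+ 3 * a * c -_) (sym eq) ⟩
    + 3 * a * c - + 2 * a * b            ∎

  2ab≡c[3a-b] : + 2 * (a * b) ≡ c * (+ 3 * a - b)
  2ab≡c[3a-b] = begin
    + 2 * (a * b)        ≡⟨ solve (a ∷ b ∷ []) ⟩
    + 2 * a * b          ≡⟨ eq ⟩
    + 3 * a * c - b * c  ≡⟨ solve (a ∷ b ∷ c ∷ []) ⟩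
    c * (+ 3 * a - b)    ∎

  3ac≡b[2a+c] : + 3 * (a * c) ≡ b * (+ 2 * a + c)
  3ac≡b[2a+c] = begin
    + 3 * (a * c)                  ≡⟨ solve (a ∷ b ∷ c ∷ []) ⟩
    (+ 3 * a * c - b * c) + b * c  ≡⟨ cong (_+ b * c) (sym eq) ⟩
    + 2 * a * b + b * c            ≡⟨ solve (a ∷ b ∷ c ∷ []) ⟩
    b * (+ 2 * a + c)              ∎

  ∣a⇒∣bc : ∀ {d} → d ∣ₛ a → d ∣ₛ b * c
  ∣a⇒∣bc d∣a = subst (_ ∣ₛ_) (sym bc≡3ac-2ab)
    (∣m∣n⇒∣m-n (∣m⇒∣m*n c (∣n⇒∣m*n (+ 3) d∣a)) (∣m⇒∣m*n b (∣n⇒∣m*n (+ 2) d∣a)))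

  ∣c⇒∣2ab : ∀ {d} → d ∣ₛ c → d ∣ₛ + 2 * (a * b)
  ∣c⇒∣2ab d∣c = subst (_ ∣ₛ_) (sym 2ab≡c[3a-b]) (∣m⇒∣m*n (+ 3 * a - b) d∣c)

  ∣b⇒∣3ac : ∀ {d} → d ∣ₛ b → d ∣ₛ + 3 * (a * c)
  ∣b⇒∣3ac d∣b = subst (_ ∣ₛ_) (sym 3ac≡b[2a+c]) (∣m⇒∣m*n (+ 2 * a + c) d∣b)

  2∣c⇒2∣ab : + 2 ∣ₛ c → + 2 ∣ₛ a * b
  2∣c⇒2∣ab (divides s c≡s*2) = decidable-stable (+ 2 ∣? a * b) λ 2∤ab →
    2∤ab (subst (+ 2 ∣ₛ_) (sym ab≡s[3a-b]) (∣n⇒∣m*n s (2∣3a-b 2∤ab)))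
    where
    ab≡s[3a-b] : a * b ≡ s * (+ 3 * a - b)
    ab≡s[3a-b] = *-cancelˡ-≡ (+ 2) _ _ (begin
      + 2 * (a * b)              ≡⟨ 2ab≡c[3a-b] ⟩
      c * (+ 3 * a - b)          ≡⟨ cong (_* (+ 3 * a - b)) c≡s*2 ⟩
      s * + 2 * (+ 3 * a - b)    ≡⟨ solve (a ∷ b ∷ s ∷ []) ⟩
      + 2 * (s * (+ 3 * a - b))  ∎)
    2a+[a-b]≡3a-b : + 2 * a + (a - b) ≡ + 3 * a - b
    2a+[a-b]≡3a-b = solve (a ∷ b ∷ [])
    2∣3a-b : ¬ (+ 2 ∣ₛ a * b) → + 2 ∣ₛ + 3 * a - b
    2∣3a-b 2∤ab = subst (+ 2 ∣ₛ_) 2a+[a-b]≡3a-b (∣m∣n⇒∣m+n (∣m⇒∣m*n a ∣-refl)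
      (¬2∣∧¬2∣⇒2∣- a b (λ 2∣a → 2∤ab (∣m⇒∣m*n b 2∣a))
                       (λ 2∣b → 2∤ab (∣n⇒∣m*n a 2∣b))))

  prime∣c⇒∣ab : ∀ {p} → Prime p → (+ p) ∣ c → (+ p) ∣ a * b
  prime∣c⇒∣ab {p} p-prime p∣c
    with prime∣*⇒∣⊎∣ (+ 2) (a * b) p-prime (∣⇒∣ᵤ (∣c⇒∣2ab (∣ᵤ⇒∣ {+ p} {c} p∣c)))
  ... | inj₂ p∣ab = p∣ab
  ... | inj₁ p∣2 with prime∣prime⇒≡ p-prime prime[2] p∣2
  ...   | refl = ∣⇒∣ᵤ (2∣c⇒2∣ab (∣ᵤ⇒∣ p∣c))

  prime∣b⇒≡3⊎∣ac : ∀ {p} → Prime p → (+ p) ∣ b → p ≡ 3 ⊎ (+ p) ∣ a * c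
  prime∣b⇒≡3⊎∣ac {p} p-prime p∣b = Sum.map₁ (prime∣prime⇒≡ p-prime prime[3])
    (prime∣*⇒∣⊎∣ (+ 3) (a * c) p-prime (∣⇒∣ᵤ (∣b⇒∣3ac (∣ᵤ⇒∣ {+ p} {b} p∣b))))

lemma2 : (a b c : ℤ) → a ≢ c → (k : ℕ) → (+ k) * (a - c) ≡ a →
           (n : ℕ) → n ≡ 3 ℕ.* k →
           (+ 2) * a * b ≡ (+ 3) * a * c - b * c →
           ((p : ℕ) → Prime p →
              ¬ (((+ p) ∣ a × ¬ ((+ p) ∣ b * c)) ⊎ ((+ p) ∣ c × ¬ ((+ p) ∣ a * b))))
           × ((p : ℕ) → Prime p → (+ p) ∣ b → ¬ ((+ p) ∣ a * c) →
              p ≡ 3 × 3 ℕD.∣ n × ¬ (9 ℕD.∣ n))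
lemma2 a b c _ k k[a-c]≡a _ refl eq = only-a-or-only-c-impossible , only-b⇒3∥n
  where
  open DivisorsOf a b c eq

  only-a-or-only-c-impossible : (p : ℕ) → Prime p →
    ¬ (((+ p) ∣ a × ¬ ((+ p) ∣ b * c)) ⊎ ((+ p) ∣ c × ¬ ((+ p) ∣ a * b)))
  only-a-or-only-c-impossible p _ (inj₁ (p∣a , p∤bc)) =
    p∤bc (∣⇒∣ᵤ (∣a⇒∣bc (∣ᵤ⇒∣ {+ p} {a} p∣a)))
  only-a-or-only-c-impossible p p-prime (inj₂ (p∣c , p∤ab)) =
    p∤ab (prime∣c⇒∣ab p-prime p∣c)

  3∣k⇒3∣ac : 3 ℕD.∣ k → (+ 3) ∣ a * c
  3∣k⇒3∣ac 3∣k = ∣⇒∣ᵤ (∣m⇒∣m*n c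
    (subst (+ 3 ∣ₛ_) k[a-c]≡a (∣m⇒∣m*n (a - c) (∣ᵤ⇒∣ {+ 3} {+ k} 3∣k))))

  only-b⇒3∥n : (p : ℕ) → Prime p → (+ p) ∣ b → ¬ ((+ p) ∣ a * c) →
    p ≡ 3 × 3 ℕD.∣ 3 ℕ.* k × ¬ (9 ℕD.∣ 3 ℕ.* k)
  only-b⇒3∥n p p-prime p∣b p∤ac with prime∣b⇒≡3⊎∣ac p-prime p∣b
  ... | inj₂ p∣ac = contradiction p∣ac p∤ac
  ... | inj₁ refl = refl , ℕD.m∣m*n k , p∤ac ∘ 3∣k⇒3∣ac ∘ ℕD.*-cancelˡ-∣ 3
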